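{- Let $D$ be an acyclic digraph, let $H$ be a hole of length $l \geq 5$ in the underlying graph $U(D)$, and let $C$ be the cycle obtained from $H$ by $\Gamma_H$. Then: (1) the length of $C$ is at least $l - \lfloor l/2 \rfloor$ and at most $l-1$; (2) each vertex on $C$ has at least one out-neighbor (in $D$) in $V(H)$; (3) the number of vertices on $C$ having two out-neighbors in $V(H)$ equals $|\Gamma_H|$; (4) for each chord $uv$ of $C$ in $P(D)$ (i.e. each edge of $P(D)$ joining two vertices nonconsecutive on $C$), $uv$ is a cared edge, and every vertex taking care of $uv$ belongs to $V(D) - V(H)$.
   Context: The underlying graph $U(D)$ of a digraph $D$ has vertex set $V(D)$ and an edge $uv$ whenever $(u,v)\in A(D)$ or $(v,u)\in A(D)$. The competition graph $C(D)$ has vertex set $V(D)$ and an edge $uv$ ($u\ne v$) iff $u,v$ have a common out-neighbor in $D$. The phylogeny graph $P(D)$ has vertex set $V(D)$ and edge set $E(U(D))\cup E(C(D))$. An edge of $P(D)$ is a cared edge if it lies in $E(C(D))$ but not in $E(U(D))$; a vertex $w$ takes care of a cared edge $xy$ if $w$ is a common out-neighbor of $x$ and $y$. A hole is an induced cycle of length at least $4$. Given a hole $H = v_1v_2\cdots v_lv_1$ in $U(D)$ with $l\ge5$, let $D_H$ be the subdigraph of $D$ induced by $V(H)$, and let $\Gamma_H$ be the set of vertices of $H$ having exactly two in-neighbors in $D_H$ (this set is nonempty and no two of its vertices are consecutive on $H$). The cycle obtained from $H$ by $\Gamma_H$ is the cycle $C$ in $P(D)$ whose vertices are those of $V(H)-\Gamma_H$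 in the cyclic order of $H$; that is, $C$ is obtained from $H$ by replacing, for each $v_a\in\Gamma_H$, the path $v_{a-1}v_av_{a+1}$ by the edge $v_{a-1}v_{a+1}$ (an edge of $P(D)$ since $v_a$ is a common out-neighbor). Its length is $l-|\Gamma_H|$. -}

module Defs where

open import Data.Nat using (ℕ; zero; suc; _+_; _∸_; _≡ᵇ_)
open import Data.Fin using (Fin; toℕ) renaming (zero to fz; suc to fs)
open import Data.Bool using (Bool; true; false; not; if_then_else_)
import Data.Bool as B
open import Data.List using (List; map; filter; allFin; length; lookup)
open import Data.Product using (Σ; ∃; _×_)
open import Data.Sum using (_⊎_)
open import Data.Empty using (⊥)
open import Relation.Nullary using (¬_)
open import Relation.Binary.PropositionalEquality using (_≡_; _≢_)
open import Relation.Binary.Construct.Closure.Transitive using (TransClosure)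
open import Function using (_∘_; Injective)

Digraph : ℕ → Set
Digraph n = Fin n → Fin n → Bool

module _ {n : ℕ} (D : Digraph n) where

  Arc : Fin n → Fin n → Set
  Arc u v = D u v ≡ true

  Acyclic : Set
  Acyclic = ∀ v → ¬ TransClosure Arc v v

  UEdge : Fin n → Fin n → Set
  UEdge u v = Arc u v ⊎ Arc v u

  -- edge of the competition graph C(D)
  CEdge : Fin n → Fin n → Set
  CEdge u v = u ≢ v × ∃ λ w → Arc u w × Arc v w

  PEdge : Fin n → Fin n → Set
  PEdge u v = UEdge u v ⊎ CEdge u v

  Cared : Fin n → Fin n → Set
  Cared u v = CEdge u v × ¬ UEdge u v

  TakesCare : Fin n → Fin n → Fin n → Set
  TakesCare w u v = Arc u w × Arc v w

countT : ∀ {k} → (Fin k → Bool) → ℕ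
countT {zero} f = 0
countT {suc k} f = (if f fz then 1 else 0) + countT (f ∘ fs)

CycSucc : ∀ {k} → Fin k → Fin k → Set
CycSucc {k} i j = (toℕ j ≡ suc (toℕ i)) ⊎ (toℕ i ≡ k ∸ 1 × toℕ j ≡ 0)

CycAdj : ∀ {k} → Fin k → Fin k → Set
CycAdj i j = CycSucc i j ⊎ CycSucc j i

IsHole : ∀ {n} → Digraph n → (l : ℕ) → (Fin l → Fin n) → Set
IsHole D l h = (4 Data.Nat.≤ l) × Injective _≡_ _≡_ h
             × (∀ i j → (UEdge D (h i) (h j) → CycAdj i j) × (CycAdj i j → UEdge D (h i) (h j)))

module _ {n : ℕ} (D : Digraph n) {l : ℕ} (h : Fin l → Fin n) where

  inDegH : Fin n → ℕ
  inDegH v = countT (λ j → D (h j) v)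

  outDegH : Fin n → ℕ
  outDegH v = countT (λ j → D v (h j))

  inΓ : Fin l → Bool
  inΓ i = inDegH (h i) ≡ᵇ 2

  ΓSize : ℕ
  ΓSize = countT inΓ

  -- the cycle C obtained from H by Γ_H: vertices of V(H) - Γ_H in the cyclic order of H
  Cverts : List (Fin n)
  Cverts = map h (filter (λ i → not (inΓ i) B.≟ true) (allFin l))

  Clen : ℕ
  Clen = length Cverts

  Cv : Fin Clen → Fin n
  Cv = lookup Cverts

-- Orient every edge of H. A vertex of H lies in Γ_H exactly when it is a sink of D_H, and has
-- two out-neighbours in V(H) exactly when it is a source. Going around the cycle, sinks and
-- sources alternate, so there are |Γ_H| of each; they are disjoint, so 2|Γ_H| ≤ l; and since D
-- is acyclic the orientation is not constant, so |Γ_H| ≥ 1. As C has l − |Γ_H| vertices this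
-- gives (1); (2) and (3) hold because a non-sink has an out-arc inside H and every source lies
-- on C. For (4): H is induced, so a U(D)-edge between vertices of C is an edge of H, and a common
-- out-neighbour in V(H) of two vertices of C is a sink whose two H-neighbours they are; either
-- way the two vertices are consecutive on C.
module Submission where

open import Defs
open import Data.Bool using (Bool; true; false; not; if_then_else_; _∧_; _∨_)
import Data.Bool as B
open import Data.Bool.Properties using (∧-inverseʳ; ∨-inverseʳ; ∧-zeroʳ; ∧-identityʳ; not-injective)
open import Data.Empty using (⊥; ⊥-elim)
open import Data.Fin using (Fin; toℕ; fromℕ; fromℕ<; inject₁; cast) renaming (zero to fz; suc to fs)
import Data.Fin as F
import Data.Fin.Properties as Finₚ
open import Data.Fin.Properties using (toℕ-injective; toℕ<n; toℕ-fromℕ; toℕ-fromℕ<; toℕ-inject₁; toℕ-cast)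
open import Data.List using (List; []; _∷_; map; filter; allFin; length; lookup; tabulate)
open import Data.List.Properties using (length-map)
open import Data.List.Membership.Propositional.Properties using (∈-lookup; ∈-filter⁻)
import Data.List.Relation.Unary.All as All
open import Data.List.Relation.Unary.AllPairs using (AllPairs; _∷_)
open import Data.List.Relation.Unary.AllPairs.Properties using (filter⁺; tabulate⁺-<)
open import Data.Nat using (ℕ; zero; suc; _+_; _*_; _∸_; _≤_; _<_; z≤n; s≤s; _≡ᵇ_; _/_; _<?_)
open import Data.Nat.Properties
open import Data.Nat.DivMod using (m*n/n≡m; /-monoˡ-≤)
open import Data.Product using (∃; _×_; _,_; proj₁; proj₂)
open import Data.Sum using (_⊎_; inj₁; inj₂; swap)
import Data.Sum as Sum
open import Function using (_∘_; flip)
open import Relation.Binary.Construct.Closure.Transitive using (TransClosure; [_]; _∷_; _∷ʳ_)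
open import Relation.Binary.Definitions using (tri<; tri≈; tri>)
open import Relation.Binary.PropositionalEquality
open import Relation.Nullary using (¬_; yes; no)

predᶜ : ∀ {m} → Fin (suc m) → Fin (suc m)
predᶜ {m} fz = fromℕ m
predᶜ (fs i) = inject₁ i

sucᶜ : ∀ {m} → Fin (suc m) → Fin (suc m)
sucᶜ {m} i with toℕ i <? m
... | yes i<m = fromℕ< (s≤s i<m)
... | no _ = fz

CycSucc-predᶜ : ∀ {m} (i : Fin (suc m)) → CycSucc (predᶜ i) i
CycSucc-predᶜ {m} fz = inj₂ (toℕ-fromℕ m , refl)
CycSucc-predᶜ (fs i) = inj₁ (cong suc (sym (toℕ-inject₁ i)))

CycSucc-sucᶜ : ∀ {m} (i : Fin (suc m)) → CycSucc i (sucᶜ i)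
CycSucc-sucᶜ {m} i with toℕ i <? m
... | yes i<m = inj₁ (toℕ-fromℕ< (s≤s i<m))
... | no i≮m = inj₂ (≤-antisym (≤-pred (toℕ<n i)) (≮⇒≥ i≮m) , refl)

CycSucc-functional : ∀ {m} {i j j′ : Fin (suc m)} → CycSucc i j → CycSucc i j′ → j ≡ j′
CycSucc-functional (inj₁ j≡1+i) (inj₁ j′≡1+i) = toℕ-injective (trans j≡1+i (sym j′≡1+i))
CycSucc-functional {m} {j = j} (inj₁ j≡1+i) (inj₂ (i≡m , _)) =
  ⊥-elim (<-irrefl refl (subst (_< suc m) (trans j≡1+i (cong suc i≡m)) (toℕ<n j)))
CycSucc-functional {m} {j′ = j′} (inj₂ (i≡m , _)) (inj₁ j′≡1+i) =
  ⊥-elim (<-irrefl refl (subst (_< suc m) (trans j′≡1+i (cong suc i≡m)) (toℕ<n j′)))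
CycSucc-functional (inj₂ (_ , j≡0)) (inj₂ (_ , j′≡0)) = toℕ-injective (trans j≡0 (sym j′≡0))

CycSucc-injective : ∀ {m} {i j j′ : Fin (suc m)} → CycSucc j i → CycSucc j′ i → j ≡ j′
CycSucc-injective (inj₁ i≡1+j) (inj₁ i≡1+j′) = toℕ-injective (suc-injective (trans (sym i≡1+j) i≡1+j′))
CycSucc-injective (inj₁ i≡1+j) (inj₂ (_ , i≡0)) with () ← trans (sym i≡1+j) i≡0
CycSucc-injective (inj₂ (_ , i≡0)) (inj₁ i≡1+j′) with () ← trans (sym i≡1+j′) i≡0
CycSucc-injective (inj₂ (j≡m , _)) (inj₂ (j′≡m , _)) = toℕ-injective (trans j≡m (sym j′≡m))

sucᶜ-predᶜ : ∀ {m} (i : Fin (suc m)) → sucᶜ (predᶜ i) ≡ i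
sucᶜ-predᶜ i = CycSucc-functional (CycSucc-sucᶜ (predᶜ i)) (CycSucc-predᶜ i)

CycSucc-asym : ∀ {m} → 2 ≤ m → {a b : Fin (suc m)} → CycSucc a b → ¬ CycSucc b a
CycSucc-asym _ {a} (inj₁ b≡1+a) (inj₁ a≡1+b) = m≢1+n+m (toℕ a) {1} (trans a≡1+b (cong suc b≡1+a))
CycSucc-asym 2≤m (inj₁ b≡1+a) (inj₂ (b≡m , a≡0)) =
  <-irrefl refl (subst (2 ≤_) (trans (sym b≡m) (trans b≡1+a (cong suc a≡0))) 2≤m)
CycSucc-asym 2≤m (inj₂ (a≡m , b≡0)) (inj₁ a≡1+b) =
  <-irrefl refl (subst (2 ≤_) (trans (sym a≡m) (trans a≡1+b (cong suc b≡0))) 2≤m)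
CycSucc-asym 2≤m (inj₂ (a≡m , _)) (inj₂ (_ , a≡0)) = n≮0 (subst (2 ≤_) (trans (sym a≡m) a≡0) 2≤m)

predᶜ≢sucᶜ : ∀ {m} → 2 ≤ m → (i : Fin (suc m)) → predᶜ i ≢ sucᶜ i
predᶜ≢sucᶜ 2≤m i eq = CycSucc-asym 2≤m (CycSucc-predᶜ i) (subst (CycSucc i) (sym eq) (CycSucc-sucᶜ i))

CycAdj⇒predᶜ⊎sucᶜ : ∀ {m} {j i : Fin (suc m)} → CycAdj j i → j ≡ predᶜ i ⊎ j ≡ sucᶜ i
CycAdj⇒predᶜ⊎sucᶜ {i = i} (inj₁ j→i) = inj₁ (CycSucc-injective j→i (CycSucc-predᶜ i))
CycAdj⇒predᶜ⊎sucᶜ {i = i} (inj₂ i→j) = inj₂ (CycSucc-functional i→j (CycSucc-sucᶜ i))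

CycSucc-cast : ∀ {k k′} (eq : k ≡ k′) {i j : Fin k} → CycSucc (cast eq i) (cast eq j) → CycSucc i j
CycSucc-cast eq {i} {j} (inj₁ j≡1+i) = inj₁ (begin
  toℕ j            ≡⟨ toℕ-cast eq j ⟨
  toℕ (cast eq j)  ≡⟨ j≡1+i ⟩
  suc (toℕ (cast eq i)) ≡⟨ cong suc (toℕ-cast eq i) ⟩
  suc (toℕ i)      ∎)
  where open ≡-Reasoning
CycSucc-cast eq {i} {j} (inj₂ (i≡last , j≡0)) =
  inj₂ (trans (sym (toℕ-cast eq i)) (trans i≡last (cong (_∸ 1) (sym eq))) , trans (sym (toℕ-cast eq j)) j≡0)

bit : Bool → ℕ
bit b = if b then 1 else 0

bit+bit≡ᵇ2 : ∀ a b → (bit a + bit b ≡ᵇ 2) ≡ a ∧ b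
bit+bit≡ᵇ2 true  true  = refl
bit+bit≡ᵇ2 true  false = refl
bit+bit≡ᵇ2 false true  = refl
bit+bit≡ᵇ2 false false = refl

countT-cong : ∀ {k} {f g : Fin k → Bool} → (∀ i → f i ≡ g i) → countT f ≡ countT g
countT-cong {zero} _ = refl
countT-cong {suc k} f≗g = cong₂ _+_ (cong bit (f≗g fz)) (countT-cong (f≗g ∘ fs))

countT-≡0 : ∀ {k} (f : Fin k → Bool) → (∀ j → f j ≢ true) → countT f ≡ 0
countT-≡0 {zero} f _ = refl
countT-≡0 {suc k} f none with f fz in f0
... | true = ⊥-elim (none fz f0)
... | false = countT-≡0 (f ∘ fs) (none ∘ fs)

countT-single : ∀ {k} (f : Fin k → Bool) (p : Fin k) → (∀ j → f j ≡ true → j ≡ p) → countT f ≡ bit (f p)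
countT-single f fz only-p =
  trans (cong (bit (f fz) +_) (countT-≡0 (f ∘ fs) λ j fj → Finₚ.0≢1+n (sym (only-p (fs j) fj)))) (+-identityʳ _)
countT-single f (fs p) only-p with f fz in f0
... | true with () ← only-p fz f0
... | false = countT-single (f ∘ fs) p (λ j fj → Finₚ.suc-injective (only-p (fs j) fj))

countT-pair : ∀ {k} (f : Fin k → Bool) (p q : Fin k) → p ≢ q → (∀ j → f j ≡ true → j ≡ p ⊎ j ≡ q) →
  countT f ≡ bit (f p) + bit (f q)
countT-pair f fz fz p≢q _ = ⊥-elim (p≢q refl)
countT-pair f fz (fs q) _ only-pq = cong (bit (f fz) +_) (countT-single (f ∘ fs) q λ j fj → right (only-pq (fs j) fj))
  where right : ∀ {j} → fs j ≡ fz ⊎ fs j ≡ fs q → j ≡ q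
        right (inj₂ refl) = refl
countT-pair f (fs p) fz _ only-pq =
  trans (cong (bit (f fz) +_) (countT-single (f ∘ fs) p λ j fj → left (only-pq (fs j) fj))) (+-comm (bit (f fz)) _)
  where left : ∀ {j} → fs j ≡ fs p ⊎ fs j ≡ fz → j ≡ p
        left (inj₁ refl) = refl
countT-pair f (fs p) (fs q) p≢q only-pq with f fz | only-pq fz
... | true | only-0 with only-0 refl
...   | inj₁ ()
...   | inj₂ ()
countT-pair f (fs p) (fs q) p≢q only-pq | false | _ =
  countT-pair (f ∘ fs) p q (p≢q ∘ cong fs) λ j fj → Sum.map Finₚ.suc-injective Finₚ.suc-injective (only-pq (fs j) fj)

countT≡0⇒false : ∀ {k} (f : Fin k → Bool) → countT f ≡ 0 → ∀ i → f i ≡ false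
countT≡0⇒false {suc k} f none i with f fz in f0
countT≡0⇒false {suc k} f () _ | true
countT≡0⇒false {suc k} f _ fz | false = f0
countT≡0⇒false {suc k} f none (fs i) | false = countT≡0⇒false (f ∘ fs) none i

countT-≤ : ∀ {k} (f : Fin k → Bool) → countT f ≤ k
countT-≤ {zero} f = z≤n
countT-≤ {suc k} f with f fz
... | true = s≤s (countT-≤ (f ∘ fs))
... | false = m≤n⇒m≤1+n (countT-≤ (f ∘ fs))

countT-∨ : ∀ {k} (f g : Fin k → Bool) → (∀ i → f i ∧ g i ≡ false) → countT f + countT g ≡ countT (λ i → f i ∨ g i)
countT-∨ {zero} f g _ = refl
countT-∨ {suc k} f g disjoint with f fz | g fz | disjoint fz | countT-∨ (f ∘ fs) (g ∘ fs) (disjoint ∘ fs)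
... | true | false | _ | ih = cong suc ih
... | false | true | _ | ih = trans (+-suc (countT (f ∘ fs)) _) (cong suc ih)
... | false | false | _ | ih = ih

countT-true : ∀ k → countT {k} (λ _ → true) ≡ k
countT-true zero = refl
countT-true (suc k) = cong suc (countT-true k)

countT-not : ∀ {k} (f : Fin k → Bool) → countT f + countT (not ∘ f) ≡ k
countT-not {k} f = begin
  countT f + countT (not ∘ f)       ≡⟨ countT-∨ f (not ∘ f) (∧-inverseʳ ∘ f) ⟩
  countT (λ i → f i ∨ not (f i))    ≡⟨ countT-cong (∨-inverseʳ ∘ f) ⟩
  countT {k} (λ _ → true)           ≡⟨ countT-true k ⟩
  k                                 ∎
  where open ≡-Reasoning

falls rises : ∀ {m} → (Fin (suc m) → Bool) → Fin (suc m) → Bool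
falls g i = g (predᶜ i) ∧ not (g i)
rises g i = not (g (predᶜ i)) ∧ g i

linear-falls≡rises : ∀ m (g : Fin (suc m) → Bool) →
  countT (λ i → g (inject₁ i) ∧ not (g (fs i))) + bit (g (fromℕ m)) ≡
  countT (λ i → not (g (inject₁ i)) ∧ g (fs i)) + bit (g fz)
linear-falls≡rises zero g = refl
linear-falls≡rises (suc m) g with linear-falls≡rises m (g ∘ fs)
... | ih with g fz | g (fs fz)
...   | true  | true  = ih
...   | true  | false = trans (cong suc ih) (sym (+-suc _ 0))
...   | false | true  = trans ih (+-suc _ 0)
...   | false | false = ih

countT-falls≡rises : ∀ {m} (g : Fin (suc m) → Bool) → countT (falls g) ≡ countT (rises g)
countT-falls≡rises {m} g with linear-falls≡rises m g
... | ih with g (fromℕ m) | g fz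
...   | true  | true  = +-cancelʳ-≡ _ _ _ ih
...   | true  | false = trans (+-comm 1 _) (trans ih (+-identityʳ _))
...   | false | true  = trans (sym (+-identityʳ _)) (trans ih (+-comm _ 1))
...   | false | false = +-cancelʳ-≡ _ _ _ ih

countT-falls+rises≤ : ∀ {m} (g : Fin (suc m) → Bool) → countT (falls g) + countT (rises g) ≤ suc m
countT-falls+rises≤ {m} g = subst (_≤ suc m) (sym (countT-∨ (falls g) (rises g) (λ i → exclusive (g (predᶜ i)) (g i))))
                                           (countT-≤ (λ i → falls g i ∨ rises g i))
  where
  exclusive : ∀ a b → (a ∧ not b) ∧ (not a ∧ b) ≡ false
  exclusive true  b = ∧-zeroʳ (not b)
  exclusive false b = refl

rises∧not-falls : ∀ {m} (g : Fin (suc m) → Bool) i → rises g i ∧ not (falls g i) ≡ rises g i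
rises∧not-falls g i with g (predᶜ i) | g i
... | true  | _     = refl
... | false | true  = refl
... | false | false = refl

linear-constant : ∀ m (g : Fin (suc m) → Bool) → (∀ i → g (inject₁ i) ≡ g (fs i)) → ∀ i → g i ≡ g fz
linear-constant m g _ fz = refl
linear-constant (suc m) g step (fs i) = trans (linear-constant m (g ∘ fs) (step ∘ fs) i) (sym (step fz))

countT-falls≡0⇒constant : ∀ {m} (g : Fin (suc m) → Bool) → countT (falls g) ≡ 0 → ∀ i → g i ≡ g fz
countT-falls≡0⇒constant {m} g no-falls = linear-constant m g λ i → steady (g (inject₁ i)) (g (fs i)) (no-fall (fs i)) (no-rise (fs i))
  where
  no-fall : ∀ i → falls g i ≡ false
  no-fall = countT≡0⇒false (falls g) no-falls
  no-rise : ∀ i → rises g i ≡ false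
  no-rise = countT≡0⇒false (rises g) (trans (sym (countT-falls≡rises g)) no-falls)
  steady : ∀ a b → a ∧ not b ≡ false → not a ∧ b ≡ false → a ≡ b
  steady true  true  _ _ = refl
  steady false false _ _ = refl

m+m≤n⇒m≤n/2 : ∀ {m n} → m + m ≤ n → m ≤ n / 2
m+m≤n⇒m≤n/2 {m} {n} m+m≤n = subst (_≤ n / 2) (m*n/n≡m m 2) (/-monoˡ-≤ 2 (subst (_≤ n) m+m≡m*2 m+m≤n))
  where
  m+m≡m*2 : m + m ≡ m * 2
  m+m≡m*2 = trans (cong (m +_) (sym (+-identityʳ m))) (*-comm 2 m)

module _ {a r} {A : Set a} {R : A → A → Set r} where

  walk : ∀ m (g : Fin (suc (suc m)) → A) → (∀ i → R (g (inject₁ i)) (g (fs i))) → TransClosure R (g fz) (g (fromℕ (suc m)))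
  walk zero g step = [ step fz ]
  walk (suc m) g step = step fz ∷ walk m (g ∘ fs) (step ∘ fs)

  closed-walk : ∀ m (g : Fin (suc (suc m)) → A) → (∀ i → R (g (predᶜ i)) (g i)) → TransClosure R (g fz) (g fz)
  closed-walk m g step = walk m g (step ∘ fs) ∷ʳ step fz

  TransClosure-flip : ∀ {x y} → TransClosure (flip R) x y → TransClosure R y x
  TransClosure-flip [ r ] = [ r ]
  TransClosure-flip (r ∷ rs) = TransClosure-flip rs ∷ʳ r

countL : ∀ {a} {A : Set a} → (A → Bool) → List A → ℕ
countL g [] = 0
countL g (x ∷ xs) = bit (g x) + countL g xs

module _ {a} {A : Set a} where

  countT-lookup : (g : A → Bool) (xs : List A) → countT (g ∘ lookup xs) ≡ countL g xs
  countT-lookup g [] = refl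
  countT-lookup g (x ∷ xs) = cong (bit (g x) +_) (countT-lookup g xs)

  countL-filter : (g b : A → Bool) (xs : List A) →
    countL g (filter (λ x → b x B.≟ true) xs) ≡ countL (λ x → g x ∧ b x) xs
  countL-filter g b [] = refl
  countL-filter g b (x ∷ xs) with b x
  ... | false rewrite ∧-zeroʳ (g x) = countL-filter g b xs
  ... | true rewrite ∧-identityʳ (g x) = cong (bit (g x) +_) (countL-filter g b xs)

  countL-tabulate : (g : A → Bool) {k : ℕ} (f : Fin k → A) → countL g (tabulate f) ≡ countT (g ∘ f)
  countL-tabulate g {zero} f = refl
  countL-tabulate g {suc k} f = cong (bit (g (f fz)) +_) (countL-tabulate g (f ∘ fs))

  AllPairs-lookup : ∀ {r} {R : A → A → Set r} {xs : List A} → AllPairs R xs →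
    ∀ i j → toℕ i < toℕ j → R (lookup xs i) (lookup xs j)
  AllPairs-lookup (Rx ∷ _) fz (fs j) _ = All.lookup Rx (∈-lookup j)
  AllPairs-lookup (_ ∷ Rxs) (fs i) (fs j) (s≤s i<j) = AllPairs-lookup Rxs i j i<j

  module _ {b} {B : Set b} (f : A → B) where

    countL-map : (g : B → Bool) (xs : List A) → countL g (map f xs) ≡ countL (g ∘ f) xs
    countL-map g [] = refl
    countL-map g (x ∷ xs) = cong (bit (g (f x)) +_) (countL-map g xs)

    lookup-map : (xs : List A) (i : Fin (length (map f xs))) → lookup (map f xs) i ≡ f (lookup xs (cast (length-map f xs) i))
    lookup-map (x ∷ xs) fz = refl
    lookup-map (x ∷ xs) (fs i) = lookup-map xs i

module StrictlyIncreasing {N : ℕ} (L : List (Fin N)) (L↗ : AllPairs F._<_ L) where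

  key : Fin (length L) → ℕ
  key c = toℕ (lookup L c)

  key-mono : ∀ c d → toℕ c < toℕ d → key c < key d
  key-mono = AllPairs-lookup L↗

  key-below-fromℕ< : ∀ {k} (k<len : k < length L) c → toℕ c < k → key c < key (fromℕ< k<len)
  key-below-fromℕ< k<len c c<k = key-mono c (fromℕ< k<len) (subst (toℕ c <_) (sym (toℕ-fromℕ< k<len)) c<k)

  key-above-fromℕ< : ∀ {k} (k<len : k < length L) c → k < toℕ c → key (fromℕ< k<len) < key c
  key-above-fromℕ< k<len c k<c = key-mono (fromℕ< k<len) c (subst (_< toℕ c) (sym (toℕ-fromℕ< k<len)) k<c)

  consecutive-keys : ∀ a b → key a < key b → (∀ c → key a < key c → key c < key b → ⊥) → CycSucc a b
  consecutive-keys a b ka<kb nothing-between with <-cmp (toℕ a) (toℕ b)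
  ... | tri≈ _ a≡b _ = ⊥-elim (<-irrefl (cong key (toℕ-injective a≡b)) ka<kb)
  ... | tri> _ _ b<a = ⊥-elim (<-asym ka<kb (key-mono b a b<a))
  ... | tri< a<b _ _ with m≤n⇒m<n∨m≡n a<b
  ...   | inj₂ 1+a≡b = inj₁ (sym 1+a≡b)
  ...   | inj₁ 1+a<b = ⊥-elim (nothing-between _ (key-below-fromℕ< 1+a<len a (n<1+n _)) (key-above-fromℕ< 1+a<len b 1+a<b))
    where
    1+a<len : suc (toℕ a) < length L
    1+a<len = <-trans 1+a<b (toℕ<n b)

  extreme-keys : ∀ a b → (∀ c → key a < key c → ⊥) → (∀ c → key c < key b → ⊥) → CycSucc a b
  extreme-keys a b nothing-above nothing-below = inj₂ (a-last , b-first)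
    where
    a-last : toℕ a ≡ length L ∸ 1
    a-last with m≤n⇒m<n∨m≡n (toℕ<n a)
    ... | inj₂ 1+a≡len = cong (_∸ 1) 1+a≡len
    ... | inj₁ 1+a<len = ⊥-elim (nothing-above _ (key-below-fromℕ< 1+a<len a (n<1+n _)))
    b-first : toℕ b ≡ 0
    b-first with m≤n⇒m<n∨m≡n (z≤n {toℕ b})
    ... | inj₂ 0≡b = sym 0≡b
    ... | inj₁ 0<b = ⊥-elim (nothing-below _ (key-above-fromℕ< (<-trans 0<b (toℕ<n b)) b 0<b))

module _ {n} {D : Digraph n} (acyclic : Acyclic D) where

  Acyclic⇒arc-asym : ∀ {x y} → Arc D x y → ¬ Arc D y x
  Acyclic⇒arc-asym {x} x→y y→x = acyclic x (x→y ∷ [ y→x ])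

  Acyclic⇒UEdge-converse : ∀ x y → UEdge D x y → D y x ≡ not (D x y)
  Acyclic⇒UEdge-converse x y xy with D x y in x→y | D y x in y→x
  ... | true  | true  = ⊥-elim (Acyclic⇒arc-asym x→y y→x)
  ... | true  | false = refl
  ... | false | true  = refl
  Acyclic⇒UEdge-converse x y (inj₁ ()) | false | false
  Acyclic⇒UEdge-converse x y (inj₂ ()) | false | false

module InducedCycle {n} (D : Digraph n) (acyclic : Acyclic D) (m : ℕ) (h : Fin (3 + m) → Fin n)
  (induced : ∀ i j → (UEdge D (h i) (h j) → CycAdj i j) × (CycAdj i j → UEdge D (h i) (h j))) where

  H-neighbour : ∀ i j → UEdge D (h i) (h j) → j ≡ predᶜ i ⊎ j ≡ sucᶜ i
  H-neighbour i j e = CycAdj⇒predᶜ⊎sucᶜ (swap (proj₁ (induced i j) e))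

  forward : Fin (3 + m) → Bool
  forward i = D (h i) (h (sucᶜ i))

  arc-from-predᶜ : ∀ i → D (h (predᶜ i)) (h i) ≡ forward (predᶜ i)
  arc-from-predᶜ i = cong (D (h (predᶜ i)) ∘ h) (sym (sucᶜ-predᶜ i))

  arc-from-sucᶜ : ∀ i → D (h (sucᶜ i)) (h i) ≡ not (forward i)
  arc-from-sucᶜ i = Acyclic⇒UEdge-converse acyclic _ _ (proj₂ (induced i (sucᶜ i)) (inj₁ (CycSucc-sucᶜ i)))

  arc-to-predᶜ : ∀ i → D (h i) (h (predᶜ i)) ≡ not (forward (predᶜ i))
  arc-to-predᶜ i = trans (Acyclic⇒UEdge-converse acyclic _ _ (proj₂ (induced (predᶜ i) i) (inj₁ (CycSucc-predᶜ i))))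
                         (cong not (arc-from-predᶜ i))

  inDegH-hole : ∀ i → inDegH D h (h i) ≡ bit (forward (predᶜ i)) + bit (not (forward i))
  inDegH-hole i = trans
    (countT-pair (λ j → D (h j) (h i)) (predᶜ i) (sucᶜ i) (predᶜ≢sucᶜ (s≤s (s≤s z≤n)) i) λ j j→i → H-neighbour i j (inj₂ j→i))
    (cong₂ _+_ (cong bit (arc-from-predᶜ i)) (cong bit (arc-from-sucᶜ i)))

  outDegH-hole : ∀ i → outDegH D h (h i) ≡ bit (not (forward (predᶜ i))) + bit (forward i)
  outDegH-hole i = trans
    (countT-pair (λ j → D (h i) (h j)) (predᶜ i) (sucᶜ i) (predᶜ≢sucᶜ (s≤s (s≤s z≤n)) i) λ j i→j → H-neighbour i j (inj₁ i→j))
    (cong (_+ bit (forward i)) (cong bit (arc-to-predᶜ i)))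

  inΓ≡falls : ∀ i → inΓ D h i ≡ falls forward i
  inΓ≡falls i = trans (cong (_≡ᵇ 2) (inDegH-hole i)) (bit+bit≡ᵇ2 (forward (predᶜ i)) (not (forward i)))

  outDegH≡ᵇ2≡rises : ∀ i → (outDegH D h (h i) ≡ᵇ 2) ≡ rises forward i
  outDegH≡ᵇ2≡rises i = trans (cong (_≡ᵇ 2) (outDegH-hole i)) (bit+bit≡ᵇ2 (not (forward (predᶜ i))) (forward i))

  ΓSize≡falls : ΓSize D h ≡ countT (falls forward)
  ΓSize≡falls = countT-cong inΓ≡falls

  ΓSize≢0 : ΓSize D h ≢ 0
  ΓSize≢0 Γ≡0 with forward fz | countT-falls≡0⇒constant forward (trans (sym ΓSize≡falls) Γ≡0)
  ... | true | constant =
    acyclic (h fz) (closed-walk (suc m) h λ i → trans (arc-from-predᶜ i) (constant (predᶜ i)))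
  ... | false | constant =
    acyclic (h fz) (TransClosure-flip (closed-walk (suc m) h λ i → trans (arc-to-predᶜ i) (cong not (constant (predᶜ i)))))

  ΓSize+ΓSize≤l : ΓSize D h + ΓSize D h ≤ 3 + m
  ΓSize+ΓSize≤l = subst (λ r → ΓSize D h + r ≤ 3 + m) (trans (sym (countT-falls≡rises forward)) (sym ΓSize≡falls))
                    (subst (λ f → f + countT (rises forward) ≤ 3 + m) (sym ΓSize≡falls) (countT-falls+rises≤ forward))

  -- Cverts D h is definitionally map h positions.
  positions : List (Fin (3 + m))
  positions = filter (λ i → not (inΓ D h i) B.≟ true) (allFin (3 + m))

  countT-on-C : (g : Fin n → Bool) → countT (g ∘ Cv D h) ≡ countT (λ i → g (h i) ∧ not (inΓ D h i))
  countT-on-C g = begin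
    countT (g ∘ lookup (map h positions))                ≡⟨ countT-lookup g (map h positions) ⟩
    countL g (map h positions)                           ≡⟨ countL-map h g positions ⟩
    countL (g ∘ h) positions                             ≡⟨ countL-filter (g ∘ h) (not ∘ inΓ D h) (allFin (3 + m)) ⟩
    countL (λ i → g (h i) ∧ not (inΓ D h i)) (allFin (3 + m)) ≡⟨ countL-tabulate (λ i → g (h i) ∧ not (inΓ D h i)) (λ i → i) ⟩
    countT (λ i → g (h i) ∧ not (inΓ D h i))             ∎
    where open ≡-Reasoning

  ΓSize+Clen≡l : ΓSize D h + Clen D h ≡ 3 + m
  ΓSize+Clen≡l = begin
    ΓSize D h + Clen D h                              ≡⟨ cong (ΓSize D h +_) (countT-true (Clen D h)) ⟨
    ΓSize D h + countT {Clen D h} (λ _ → true)        ≡⟨ cong (ΓSize D h +_) (countT-on-C (λ _ → true)) ⟩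
    countT (inΓ D h) + countT (not ∘ inΓ D h)         ≡⟨ countT-not (inΓ D h) ⟩
    3 + m                                             ∎
    where open ≡-Reasoning

  Clen-bounds : (3 + m ∸ (3 + m) / 2 ≤ Clen D h) × (Clen D h ≤ 3 + m ∸ 1)
  Clen-bounds = subst (3 + m ∸ (3 + m) / 2 ≤_) l∸ΓSize≡Clen (∸-monoʳ-≤ (3 + m) (m+m≤n⇒m≤n/2 {ΓSize D h} ΓSize+ΓSize≤l))
              , subst (_≤ 3 + m ∸ 1) l∸ΓSize≡Clen (∸-monoʳ-≤ (3 + m) (n≢0⇒n>0 {ΓSize D h} ΓSize≢0))
    where
    l∸ΓSize≡Clen : 3 + m ∸ ΓSize D h ≡ Clen D h
    l∸ΓSize≡Clen = trans (cong (_∸ ΓSize D h) (sym ΓSize+Clen≡l)) (m+n∸m≡n (ΓSize D h) (Clen D h))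

  not-inΓ⇒out-arc : ∀ i → inΓ D h i ≡ false → ∃ λ j → Arc D (h i) (h j)
  not-inΓ⇒out-arc i i∉Γ with forward i in i→suc
  ... | true  = sucᶜ i , i→suc
  ... | false = predᶜ i , trans (arc-to-predᶜ i) (cong not suc→pred)
    where
    suc→pred : forward (predᶜ i) ≡ false
    suc→pred = trans (sym (∧-identityʳ _))
                 (trans (cong (λ b → forward (predᶜ i) ∧ not b) (sym i→suc)) (trans (sym (inΓ≡falls i)) i∉Γ))

  pos : Fin (Clen D h) → Fin (length positions)
  pos = cast (length-map h positions)

  Cv≡h∘position : ∀ a → Cv D h a ≡ h (lookup positions (pos a))
  Cv≡h∘position = lookup-map h positions

  position∉Γ : ∀ x → inΓ D h (lookup positions x) ≡ false
  position∉Γ x = not-injective (proj₂ (∈-filter⁻ (λ i → not (inΓ D h i) B.≟ true) {xs = allFin (3 + m)} (∈-lookup x)))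

  C-out-arc : ∀ a → ∃ λ j → Arc D (Cv D h a) (h j)
  C-out-arc a = subst (λ v → ∃ λ j → Arc D v (h j)) (sym (Cv≡h∘position a))
                      (not-inΓ⇒out-arc (lookup positions (pos a)) (position∉Γ (pos a)))

  count-outDegH≡2-on-C : countT (λ a → outDegH D h (Cv D h a) ≡ᵇ 2) ≡ ΓSize D h
  count-outDegH≡2-on-C = begin
    countT (λ a → outDegH D h (Cv D h a) ≡ᵇ 2)                  ≡⟨ countT-on-C (λ v → outDegH D h v ≡ᵇ 2) ⟩
    countT (λ i → (outDegH D h (h i) ≡ᵇ 2) ∧ not (inΓ D h i))   ≡⟨ countT-cong (λ i → cong₂ (λ r f → r ∧ not f) (outDegH≡ᵇ2≡rises i) (inΓ≡falls i)) ⟩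
    countT (λ i → rises forward i ∧ not (falls forward i))       ≡⟨ countT-cong (rises∧not-falls forward) ⟩
    countT (rises forward)                                       ≡⟨ countT-falls≡rises forward ⟨
    countT (falls forward)                                       ≡⟨ ΓSize≡falls ⟨
    ΓSize D h                                                    ∎
    where open ≡-Reasoning

  positions↗ : AllPairs F._<_ positions
  positions↗ = filter⁺ (λ i → not (inΓ D h i) B.≟ true) (tabulate⁺-< (λ i<j → i<j))

  open StrictlyIncreasing positions positions↗

  key≤ : ∀ c → key c ≤ 2 + m
  key≤ c = ≤-pred (toℕ<n (lookup positions c))

  key≢Γ : ∀ c {t} → inΓ D h t ≡ true → key c ≢ toℕ t
  key≢Γ c t∈Γ kc≡t with () ← trans (sym (position∉Γ c)) (trans (cong (inΓ D h) (toℕ-injective kc≡t)) t∈Γ)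

  CycSucc-positions : ∀ x y → CycSucc (lookup positions x) (lookup positions y) → CycSucc x y
  CycSucc-positions x y (inj₁ ky≡1+kx) =
    consecutive-keys x y (subst (key x <_) (sym ky≡1+kx) (n<1+n _))
      λ c kx<kc kc<ky → <⇒≱ kx<kc (≤-pred (subst (key c <_) ky≡1+kx kc<ky))
  CycSucc-positions x y (inj₂ (kx≡last , ky≡0)) =
    extreme-keys x y (λ c kx<kc → <⇒≱ kx<kc (subst (key c ≤_) (sym kx≡last) (key≤ c)))
                     (λ c kc<ky → n≮0 (subst (key c <_) ky≡0 kc<ky))

  CycSucc-positions-via-Γ : ∀ x y t → CycSucc (lookup positions x) t → CycSucc t (lookup positions y) →
    inΓ D h t ≡ true → CycSucc x y
  CycSucc-positions-via-Γ x y t (inj₁ t≡1+kx) (inj₁ ky≡1+t) t∈Γ =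
    consecutive-keys x y
      (<-trans (subst (key x <_) (sym t≡1+kx) (n<1+n _)) (subst (toℕ t <_) (sym ky≡1+t) (n<1+n _)))
      λ c kx<kc kc<ky → key≢Γ c t∈Γ (≤-antisym (≤-pred (subst (key c <_) ky≡1+t kc<ky))
                                               (subst (_≤ key c) (sym t≡1+kx) kx<kc))
  CycSucc-positions-via-Γ x y t (inj₁ t≡1+kx) (inj₂ (t≡last , ky≡0)) t∈Γ =
    extreme-keys x y (λ c kx<kc → key≢Γ c t∈Γ (≤-antisym (subst (key c ≤_) (sym t≡last) (key≤ c))
                                                         (subst (_≤ key c) (sym t≡1+kx) kx<kc)))
                     (λ c kc<ky → n≮0 (subst (key c <_) ky≡0 kc<ky))
  CycSucc-positions-via-Γ x y t (inj₂ (kx≡last , t≡0)) (inj₁ ky≡1+t) t∈Γ =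
    extreme-keys x y (λ c kx<kc → <⇒≱ kx<kc (subst (key c ≤_) (sym kx≡last) (key≤ c)))
                     (λ c kc<ky → key≢Γ c t∈Γ (trans (n≤0⇒n≡0 (subst (key c ≤_) t≡0 (≤-pred (subst (key c <_) ky≡1+t kc<ky))))
                                                     (sym t≡0)))
  CycSucc-positions-via-Γ x y t (inj₂ (_ , t≡0)) (inj₂ (t≡last , _)) _ with () ← trans (sym t≡0) t≡last

  C-succ : ∀ {a b} → CycSucc (pos a) (pos b) → CycSucc a b
  C-succ = CycSucc-cast (length-map h positions)

  UEdge-on-C⇒CycAdj : ∀ a b → UEdge D (Cv D h a) (Cv D h b) → CycAdj a b
  UEdge-on-C⇒CycAdj a b e =
    Sum.map (C-succ ∘ CycSucc-positions (pos a) (pos b)) (C-succ ∘ CycSucc-positions (pos b) (pos a))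
            (proj₁ (induced _ _) (subst₂ (UEdge D) (Cv≡h∘position a) (Cv≡h∘position b) e))

  arcs-into⇒inΓ : ∀ t → Arc D (h (predᶜ t)) (h t) → Arc D (h (sucᶜ t)) (h t) → inΓ D h t ≡ true
  arcs-into⇒inΓ t pred→t suc→t =
    trans (inΓ≡falls t) (cong₂ _∧_ (trans (sym (arc-from-predᶜ t)) pred→t) (trans (sym (arc-from-sucᶜ t)) suc→t))

  sink-between⇒CycSucc : ∀ x y t → lookup positions x ≡ predᶜ t → lookup positions y ≡ sucᶜ t →
    Arc D (h (lookup positions x)) (h t) → Arc D (h (lookup positions y)) (h t) → CycSucc x y
  sink-between⇒CycSucc x y t x≡pred y≡suc x→t y→t =
    CycSucc-positions-via-Γ x y t (subst (λ i → CycSucc i t) (sym x≡pred) (CycSucc-predᶜ t))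
                                  (subst (CycSucc t) (sym y≡suc) (CycSucc-sucᶜ t))
      (arcs-into⇒inΓ t (subst (λ i → Arc D (h i) (h t)) x≡pred x→t) (subst (λ i → Arc D (h i) (h t)) y≡suc y→t))

  common-out-neighbour⇒CycAdj : ∀ a b t → Cv D h a ≢ Cv D h b →
    Arc D (Cv D h a) (h t) → Arc D (Cv D h b) (h t) → CycAdj a b
  common-out-neighbour⇒CycAdj a b t a≢b a→t b→t = sides (H-neighbour t i (inj₂ i→t)) (H-neighbour t j (inj₂ j→t))
    where
    i j : Fin (3 + m)
    i = lookup positions (pos a)
    j = lookup positions (pos b)
    i→t : Arc D (h i) (h t)
    i→t = subst (λ v → Arc D v (h t)) (Cv≡h∘position a) a→t
    j→t : Arc D (h j) (h t)
    j→t = subst (λ v → Arc D v (h t)) (Cv≡h∘position b) b→t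
    i≢j : i ≢ j
    i≢j i≡j = a≢b (trans (Cv≡h∘position a) (trans (cong h i≡j) (sym (Cv≡h∘position b))))
    sides : i ≡ predᶜ t ⊎ i ≡ sucᶜ t → j ≡ predᶜ t ⊎ j ≡ sucᶜ t → CycAdj a b
    sides (inj₁ i≡pred) (inj₁ j≡pred) = ⊥-elim (i≢j (trans i≡pred (sym j≡pred)))
    sides (inj₂ i≡suc) (inj₂ j≡suc) = ⊥-elim (i≢j (trans i≡suc (sym j≡suc)))
    sides (inj₁ i≡pred) (inj₂ j≡suc) = inj₁ (C-succ (sink-between⇒CycSucc (pos a) (pos b) t i≡pred j≡suc i→t j→t))
    sides (inj₂ i≡suc) (inj₁ j≡pred) = inj₂ (C-succ (sink-between⇒CycSucc (pos b) (pos a) t j≡pred i≡suc j→t i→t))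

  C-chord-cared : ∀ a b → ¬ CycAdj a b → PEdge D (Cv D h a) (Cv D h b) →
    Cared D (Cv D h a) (Cv D h b) × (∀ w → TakesCare D w (Cv D h a) (Cv D h b) → ∀ j → w ≢ h j)
  C-chord-cared a b nonadj (inj₁ e) = ⊥-elim (nonadj (UEdge-on-C⇒CycAdj a b e))
  C-chord-cared a b nonadj (inj₂ c@(a≢b , _)) =
    (c , nonadj ∘ UEdge-on-C⇒CycAdj a b) ,
    λ { w (a→w , b→w) t refl → nonadj (common-out-neighbour⇒CycAdj a b t a≢b a→w b→w) }

lemma2p1 : ∀ {n} (D : Digraph n) → Acyclic D → (l : ℕ) → 5 ≤ l → (h : Fin l → Fin n) → IsHole D l h →
    ((l ∸ l / 2 ≤ Clen D h) × (Clen D h ≤ l ∸ 1))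
    × (∀ (a : Fin (Clen D h)) → ∃ λ j → Arc D (Cv D h a) (h j))
    × (countT (λ a → outDegH D h (Cv D h a) ≡ᵇ 2) ≡ ΓSize D h)
    × (∀ (a b : Fin (Clen D h)) → a ≢ b → ¬ CycAdj a b → PEdge D (Cv D h a) (Cv D h b) →
         Cared D (Cv D h a) (Cv D h b)
         × (∀ w → TakesCare D w (Cv D h a) (Cv D h b) → ∀ j → w ≢ h j))
lemma2p1 D acyclic _ (s≤s (s≤s (s≤s {n = m} _))) h (_ , _ , induced) =
  Clen-bounds , C-out-arc , count-outDegH≡2-on-C , λ a b _ → C-chord-cared a b
  where open InducedCycle D acyclic m h induced
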